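{- Let $\sim$ be a prelambda congruence, let $x$ be a variable and let $A$ be a term with $x \in \mathrm{Ind}_\sim(A)$. Then $[\lambda x A]D \sim A$ for every term $D$.
   Context: Let $\mathbb{V}$ be an infinite set whose elements are called variables. The set $\mathbb{T}$ of terms is the set of words inductively defined by: every variable $x$ is a term; if $A,B$ are terms then $[AB]$ is a term; if $x$ is a variable and $A$ a term then $[\lambda x A]$ is a term. Equality of terms is syntactic identity. We abbreviate $[AB]$ as $AB$ and $[\lambda x A]$ as $\lambda x A$. A binary relation $\sim$ on $\mathbb{T}$ is a congruence if it is reflexive, symmetric, transitive, and for all terms $A,B,C,D$ and every variable $x$: $A\sim B$ implies $\lambda x A \sim \lambda x B$, and $A\sim B$, $C \sim D$ imply $AC \sim BD$. A prelambda congruence is a congruence $\sim$ such that for all terms $A,B,D$ and all variables $x,y$: ($\beta_1$) $[\lambda x x]D \sim D$; ($\beta_2$) $[\lambda x y]D \sim y$ whenever $x\neq y$; ($\beta_3$) $[\lambda x[AB]]D \sim [[\lambda x A]D][[\lambda x B]D]$; ($\beta_4$) $[\lambda x[\lambda x A]]D \sim \lambda x A$; ($\beta_5$) if $x \neq y$ and $[\lambda y D]x \sim D$, then $[\lambda x[\lambda y A]]D \sim \lambda y[[\lambda x A]D]$. For a prelambda congruence $\sim$ and a term $A$, $\mathrm{Ind}_\sim(A) = \{x \in \mathbb{V} : [\lambda x A]z \sim A \text{ for some variable } z \text{ with } x \neq z\}$ (the variables of which $A$ is independent in $\sim$). -}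

module Defs where

open import Level using (Level; _⊔_; suc)
open import Data.Nat using (ℕ)
open import Data.Product using (Σ; ∃; _×_)
open import Relation.Nullary using (¬_)
open import Relation.Binary.PropositionalEquality using (_≡_)
open import Function.Definitions using (Injective)

Infinite : ∀ {v} → Set v → Set v
Infinite V = Σ (ℕ → V) (Injective _≡_ _≡_)

-- Terms over the variable set V:  x ,  [AB] ,  [λ x A]
data Term {v} (V : Set v) : Set v where
  var : V → Term V
  app : Term V → Term V → Term V
  lam : V → Term V → Term V

module _ {v ℓ : Level} {V : Set v} where

  Rel : Set (v ⊔ Level.suc ℓ)
  Rel = Term V → Term V → Set ℓ

  record IsCongruence (_∼_ : Rel) : Set (v ⊔ ℓ) where
    field
      refl  : ∀ {A} → A ∼ A
      sym   : ∀ {A B} → A ∼ B → B ∼ A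
      trans : ∀ {A B C} → A ∼ B → B ∼ C → A ∼ C
      lam-cong : ∀ {A B} (x : V) → A ∼ B → lam x A ∼ lam x B
      app-cong : ∀ {A B C D} → A ∼ B → C ∼ D → app A C ∼ app B D

  record IsPrelambdaCongruence (_∼_ : Rel) : Set (v ⊔ ℓ) where
    field
      isCongruence : IsCongruence _∼_
      β₁ : ∀ (x : V) (D : Term V) → app (lam x (var x)) D ∼ D
      β₂ : ∀ (x y : V) (D : Term V) → ¬ (x ≡ y) → app (lam x (var y)) D ∼ var y
      β₃ : ∀ (x : V) (A B D : Term V) →
           app (lam x (app A B)) D ∼ app (app (lam x A) D) (app (lam x B) D)
      β₄ : ∀ (x : V) (A D : Term V) → app (lam x (lam x A)) D ∼ lam x A
      β₅ : ∀ (x y : V) (A D : Term V) → ¬ (x ≡ y) →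
           app (lam y D) (var x) ∼ D →
           app (lam x (lam y A)) D ∼ lam y (app (lam x A) D)

  Ind : (_∼_ : Rel) → Term V → V → Set (v ⊔ ℓ)
  Ind _∼_ A x = ∃ λ (z : V) → ¬ (x ≡ z) × (app (lam x A) (var z) ∼ A)

module Submission where

open import Level using (Level)
open import Data.Product using (_,_)
open import Relation.Binary.Bundles using (Setoid)
open import Relation.Binary.PropositionalEquality using (_≢_)
import Relation.Binary.Reasoning.Setoid as SetoidReasoning
open import Defs

module PrelambdaCongruence {v ℓ : Level} {V : Set v}
  {_∼_ : Rel {v} {ℓ} {V}} (isPrelambda : IsPrelambdaCongruence _∼_) where

  open IsPrelambdaCongruence isPrelambda
  open IsCongruence isCongruence

  setoid : Setoid v ℓ
  setoid = record
    { Carrier       = Term V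
    ; _≈_           = _∼_
    ; isEquivalence = record { refl = refl ; sym = sym ; trans = trans }
    }

  open SetoidReasoning setoid

  -- β₄ kills the inner abstraction and β₂ the variable, so the outer redex is
  -- inert on the instance [λ x A] z of A.
  app-lam-instance : ∀ (x z : V) (A D : Term V) → x ≢ z →
    app (lam x (app (lam x A) (var z))) D ∼ app (lam x A) (var z)
  app-lam-instance x z A D x≢z = begin
    app (lam x (app (lam x A) (var z))) D
      ≈⟨ β₃ x (lam x A) (var z) D ⟩
    app (app (lam x (lam x A)) D) (app (lam x (var z)) D)
      ≈⟨ app-cong (β₄ x A D) (β₂ x z D x≢z) ⟩
    app (lam x A) (var z)
      ∎

  app-lam-independent : ∀ (x : V) (A : Term V) → Ind _∼_ A x →
    (D : Term V) → app (lam x A) D ∼ A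
  app-lam-independent x A (z , x≢z , A[z/x]∼A) D = begin
    app (lam x A) D
      ≈⟨ app-cong (lam-cong x (sym A[z/x]∼A)) refl ⟩
    app (lam x (app (lam x A) (var z))) D
      ≈⟨ app-lam-instance x z A D x≢z ⟩
    app (lam x A) (var z)
      ≈⟨ A[z/x]∼A ⟩
    A
      ∎

proposition4p2 : ∀ {v ℓ : Level} {V : Set v} → Infinite V →
    (_∼_ : Rel {v} {ℓ} {V}) → IsPrelambdaCongruence _∼_ →
    (x : V) (A : Term V) → Ind _∼_ A x →
    (D : Term V) → app (lam x A) D ∼ A
proposition4p2 _ _∼_ isPrelambda =
  PrelambdaCongruence.app-lam-independent isPrelambda
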